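{- Let $G$ be a directed graph without multiedges, $s,t$ nodes of $G$, and $B$ its $s$-$t$ bridge sequence. A substring $L=(e_1,\dots,e_k)$ of $B$ is safe under the $s$-$t$ walks model if and only if $L$ has no walk breaker, i.e. there is no index $1\le i<k$ together with a non-empty path from $\mathrm{head}(e_i)$ to $\mathrm{tail}(e_{i+1})$ that uses neither $e_1$ nor $e_k$.
   Context: An $s$-$t$ bridge is an edge whose removal leaves no $s$-$t$ path; all $s$-$t$ bridges appear on every $s$-$t$ path in the same order, and $B$ is the sequence of $s$-$t$ bridges in this order. For an edge $e=(u,v)$, $\mathrm{tail}(e)=u$, $\mathrm{head}(e)=v$. An $s$-$t$ walk may repeat nodes and edges. A sequence of edges is safe under the $s$-$t$ walks model if it is a substring (contiguous) of the edge sequence of every $s$-$t$ walk of $G$. -}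

module Defs where

open import Data.Nat using (ℕ)
open import Data.Fin using (Fin)
open import Data.Product using (_×_; _,_; proj₁; proj₂; ∃; ∃-syntax)
open import Data.List using (List; []; _∷_; _++_; map; head; last)
open import Data.Maybe using (just)
open import Data.List.Membership.Propositional using (_∈_; _∉_)
open import Data.List.Relation.Unary.All using (All)
open import Data.List.Relation.Unary.Unique.Propositional using (Unique)
open import Data.List.Relation.Binary.Sublist.Propositional using (_⊆_)
open import Relation.Binary.PropositionalEquality using (_≡_; _≢_)
open import Relation.Nullary using (¬_)
open import Function.Bundles using (_⇔_)

-- A directed graph on nodes Fin n is given by its edge list E : List (Edge n),
-- an edge being the pair (tail , head).  "No multiedges" = Unique E.
Edge : ℕ → Set
Edge n = Fin n × Fin n

tail : ∀ {n} → Edge n → Fin n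
tail = proj₁

head' : ∀ {n} → Edge n → Fin n
head' = proj₂

data Chain {n : ℕ} : Fin n → Fin n → List (Edge n) → Set where
  nil  : ∀ {u} → Chain u u []
  cons : ∀ {u w es} (v : Fin n) → Chain v w es → Chain u w ((u , v) ∷ es)

Walk : ∀ {n} → List (Edge n) → Fin n → Fin n → List (Edge n) → Set
Walk E u v es = All (_∈ E) es × Chain u v es

-- u-v path: a walk whose node sequence v0,...,vm is repetition free,
-- except that v0 = vm is allowed (a cycle).
Path : ∀ {n} → List (Edge n) → Fin n → Fin n → List (Edge n) → Set
Path E u v es = Walk E u v es × Unique (map tail es) × Unique (map head' es)

IsBridge : ∀ {n} → List (Edge n) → Fin n → Fin n → Edge n → Set
IsBridge E s t e = e ∈ E × ¬ (∃[ es ] (Path E s t es × e ∉ es))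

IsBridgeSeq : ∀ {n} → List (Edge n) → Fin n → Fin n → List (Edge n) → Set
IsBridgeSeq E s t B =
  Unique B × (∀ e → (e ∈ B) ⇔ IsBridge E s t e) × (∀ es → Path E s t es → B ⊆ es)

IsSubstring : ∀ {A : Set} → List A → List A → Set
IsSubstring {A} L W = ∃[ xs ] ∃[ ys ] (W ≡ xs ++ (L ++ ys))

SafeWalks : ∀ {n} → List (Edge n) → Fin n → Fin n → List (Edge n) → Set
SafeWalks E s t L = ∀ es → Walk E s t es → IsSubstring L es

-- walk breaker of L = (e1,...,ek): an index i < k (i.e. a consecutive pair
-- e_i, e_{i+1} of L) and a non-empty path from head(e_i) to tail(e_{i+1})
-- using neither e1 (= head L) nor ek (= last L).
WalkBreaker : ∀ {n} → List (Edge n) → List (Edge n) → Set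
WalkBreaker {n} E L =
  ∃[ xs ] ∃[ e ] ∃[ e' ] ∃[ ys ] (L ≡ xs ++ (e ∷ e' ∷ ys) ×
    ∃[ P ] (P ≢ [] × Path E (head' e) (tail e') P ×
      All (λ f → (head L ≢ just f) × (last L ≢ just f)) P))

-- Every edge of L is an s-t bridge, hence lies on every s-t walk, and the given s-t path π
-- meets the bridges in the order of B.
-- A walk breaker P from head(e_i) to tail(e_{i+1}) turns π into the s-t walk "π up to e_i,
-- then P, then π from e_{i+1}". As P avoids e_1, an occurrence of L in this walk must put e_i
-- right before P, so P starts with e_{i+1}; since e_{i+1} occurs in L only once, all of
-- e_{i+1} … e_k then lies in P, contradicting that P avoids e_k.
-- Conversely, cut an s-t walk after its last e_1 and follow L edge by edge. From head(e_i) the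
-- walk must use e_{i+1}, or "π up to e_i" followed by it would miss that bridge. A detour
-- before the first e_{i+1} either avoids e_k, and then contains a walk breaker, or meets e_k,
-- and then "π up to e_i, the detour up to e_k, π from e_k" misses e_{i+1}.
module Submission where

open import Defs
open import Data.Nat using (ℕ)
open import Data.Fin using (Fin)
open import Data.Product using (∃-syntax; _×_)
open import Data.List using (List)
open import Data.List.Relation.Unary.Unique.Propositional using (Unique)
open import Relation.Nullary using (¬_)
open import Function.Bundles using (_⇔_)

import Data.Fin as Fin
open import Data.Empty using (⊥; ⊥-elim)
open import Data.Maybe using (just)
open import Data.Product using (∃; ∃₂; _,_; proj₁; proj₂)
open import Data.Product.Properties using (≡-dec)
open import Data.Sum using (inj₁; inj₂; [_,_]′)
open import Data.List using ([]; _∷_; _++_; map; last)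
open import Data.List.Properties using (++-assoc; ∷ʳ-++; ∷-injectiveˡ; ∷-injectiveʳ)
open import Data.List.Relation.Unary.Any as Any using (here; there)
open import Data.List.Relation.Unary.All as All using (All; []; _∷_)
open import Data.List.Relation.Unary.All.Properties using (++⁻ˡ; All¬⇒¬Any; ¬Any⇒All¬)
open import Data.List.Relation.Unary.AllPairs using ([]; _∷_)
open import Data.List.Relation.Unary.Unique.Propositional.Properties using (map⁻; Unique[x∷xs]⇒x∉xs)
open import Data.List.Membership.Propositional using (_∈_; _∉_)
open import Data.List.Membership.Propositional.Properties using (∈-++⁺ˡ; ∈-++⁺ʳ; ∈-++⁻; ∈-∃++)
import Data.List.Membership.DecPropositional as DecMembership
open import Data.List.Relation.Binary.Subset.Propositional using (_⊆_)
open import Data.List.Relation.Binary.Sublist.Propositional as Sublist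
  using ([]; _∷_; _∷ʳ_) renaming (_⊆_ to _⊑_)
open import Data.List.Relation.Binary.Disjoint.Propositional using (Disjoint)
open import Relation.Binary.Definitions using (DecidableEquality)
open import Relation.Binary.PropositionalEquality using (_≡_; _≢_; refl; sym; trans; cong; subst; module ≡-Reasoning)
open import Relation.Nullary using (Dec; yes; no)
open import Relation.Nullary.Decidable using (decidable-stable)
open import Function using (_∘_)
open import Function.Bundles using (mk⇔; Equivalence)

module _ {A : Set} where

  unique-++⁻ˡ : ∀ xs {ys : List A} → Unique (xs ++ ys) → Unique xs
  unique-++⁻ˡ []       _         = []
  unique-++⁻ˡ (x ∷ xs) (x∉ ∷ u) = ++⁻ˡ xs x∉ ∷ unique-++⁻ˡ xs u

  unique-++⁻ʳ : ∀ xs {ys : List A} → Unique (xs ++ ys) → Unique ys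
  unique-++⁻ʳ []       u       = u
  unique-++⁻ʳ (x ∷ xs) (_ ∷ u) = unique-++⁻ʳ xs u

  unique-++⇒disjoint : ∀ xs {ys : List A} → Unique (xs ++ ys) → Disjoint xs ys
  unique-++⇒disjoint (x ∷ xs) (x∉ ∷ _) (here refl , v∈ys) = All¬⇒¬Any x∉ (∈-++⁺ʳ xs v∈ys)
  unique-++⇒disjoint (x ∷ xs) (_ ∷ u)  (there v∈xs , v∈ys) = unique-++⇒disjoint xs u (v∈xs , v∈ys)

  unique-∉-middle : ∀ xs {x : A} {ys} → Unique (xs ++ x ∷ ys) → x ∉ xs × x ∉ ys
  unique-∉-middle xs u =
    (λ x∈xs → unique-++⇒disjoint xs u (x∈xs , here refl)) ,
    Unique[x∷xs]⇒x∉xs (unique-++⁻ʳ xs u)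

  suffix-after-first : ∀ {x : A} U {V} U′ {V′} → x ∉ U → x ∉ U′ →
    U ++ x ∷ V ≡ U′ ++ x ∷ V′ → V ≡ V′
  suffix-after-first []      []       _   _    eq = ∷-injectiveʳ eq
  suffix-after-first []      (u ∷ U′) _   x∉U′ eq = ⊥-elim (x∉U′ (here (∷-injectiveˡ eq)))
  suffix-after-first (u ∷ U) []       x∉U _    eq = ⊥-elim (x∉U (here (sym (∷-injectiveˡ eq))))
  suffix-after-first (u ∷ U) (_ ∷ U′) x∉U x∉U′ eq =
    suffix-after-first U U′ (x∉U ∘ there) (x∉U′ ∘ there) (∷-injectiveʳ eq)

  -- The x shown on the left is the x of the block xs ++ x ∷ R: it is not in π₁ or xs,
  -- and if it lay in α the whole block, hence y, would lie in Z.
  aligned-suffix : ∀ {x y : A} π₁ α {Z xs R β} →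
    π₁ ++ x ∷ Z ≡ α ++ ((xs ++ x ∷ R) ++ β) →
    x ∉ π₁ → x ∉ xs → y ∈ xs ++ x ∷ R → y ∉ Z → Z ≡ R ++ β
  aligned-suffix {x} π₁ [] {xs = xs} {R} {β} eq x∉π₁ x∉xs _ _ =
    suffix-after-first π₁ xs x∉π₁ x∉xs (trans eq (++-assoc xs (x ∷ R) β))
  aligned-suffix [] (a ∷ α) eq _ _ y∈ y∉Z =
    ⊥-elim (y∉Z (subst (_ ∈_) (sym (∷-injectiveʳ eq)) (∈-++⁺ʳ α (∈-++⁺ˡ y∈))))
  aligned-suffix (p ∷ π₁) (a ∷ α) eq x∉π₁ x∉xs y∈ y∉Z =
    aligned-suffix π₁ α (∷-injectiveʳ eq) (x∉π₁ ∘ there) x∉xs y∈ y∉Z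

  prefix-⊆ : ∀ {x : A} Q {Z} ys {β} → Q ++ x ∷ Z ≡ ys ++ β → x ∉ ys → ys ⊆ Q
  prefix-⊆ []      (y ∷ ys) eq x∉ _            = ⊥-elim (x∉ (here (∷-injectiveˡ eq)))
  prefix-⊆ (q ∷ Q) (y ∷ ys) eq _  (here refl)  = here (sym (∷-injectiveˡ eq))
  prefix-⊆ (q ∷ Q) (y ∷ ys) eq x∉ (there y∈ys) =
    there (prefix-⊆ Q ys (∷-injectiveʳ eq) (x∉ ∘ there) y∈ys)

  ∷-prefix-⊆ : ∀ {x : A} Q {Z ys β} → Q ≢ [] → Q ++ x ∷ Z ≡ x ∷ (ys ++ β) → x ∉ ys → x ∷ ys ⊆ Q
  ∷-prefix-⊆ []      Q≢[] _  _   = ⊥-elim (Q≢[] refl)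
  ∷-prefix-⊆ (q ∷ Q) _    eq _   (here refl)  = here (sym (∷-injectiveˡ eq))
  ∷-prefix-⊆ (q ∷ Q) _    eq x∉ (there y∈ys) = there (prefix-⊆ Q _ (∷-injectiveʳ eq) x∉ y∈ys)

  ∉-∈⇒just≢ : ∀ {y f : A} {xs} → y ∉ xs → f ∈ xs → just y ≢ just f
  ∉-∈⇒just≢ y∉xs f∈xs refl = y∉xs f∈xs

  head-∈-prefix : ∀ {x y : A} {xs} P {R} → x ∷ xs ≡ P ++ y ∷ R → x ∈ P ++ y ∷ []
  head-∈-prefix []      eq = here (∷-injectiveˡ eq)
  head-∈-prefix (p ∷ P) eq = here (∷-injectiveˡ eq)

  last-∷-just : ∀ (x : A) xs → ∃ λ w → last (x ∷ xs) ≡ just w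
  last-∷-just x []       = x , refl
  last-∷-just x (y ∷ xs) = last-∷-just y xs

  last-∈ : ∀ {w : A} P {x R} → last (P ++ x ∷ R) ≡ just w → w ∈ x ∷ R
  last-∈ []          {R = []}    refl = here refl
  last-∈ []          {R = r ∷ R} eq   = there (last-∈ [] eq)
  last-∈ (p ∷ [])    eq = last-∈ [] eq
  last-∈ (p ∷ q ∷ P) eq = last-∈ (q ∷ P) eq

  ⊑-split : ∀ {x : A} P {R zs} → P ++ x ∷ R ⊑ zs →
    ∃₂ λ zs₁ zs₂ → zs ≡ zs₁ ++ x ∷ zs₂ × P ⊑ zs₁ × R ⊑ zs₂
  ⊑-split [] (z ∷ʳ sub) with zs₁ , zs₂ , refl , P⊑ , R⊑ ← ⊑-split [] sub =
    z ∷ zs₁ , zs₂ , refl , z ∷ʳ P⊑ , R⊑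
  ⊑-split [] (refl ∷ sub) = [] , _ , refl , [] , sub
  ⊑-split (p ∷ P) (z ∷ʳ sub) with zs₁ , zs₂ , refl , P⊑ , R⊑ ← ⊑-split (p ∷ P) sub =
    z ∷ zs₁ , zs₂ , refl , z ∷ʳ P⊑ , R⊑
  ⊑-split (p ∷ P) (refl ∷ sub) with zs₁ , zs₂ , refl , P⊑ , R⊑ ← ⊑-split P sub =
    p ∷ zs₁ , zs₂ , refl , refl ∷ P⊑ , R⊑

  module _ (_≟_ : DecidableEquality A) where
    open DecMembership _≟_ using (_∈?_)

    first-occurrence : ∀ {x xs} → x ∈ xs → ∃₂ λ U V → xs ≡ U ++ x ∷ V × x ∉ U
    first-occurrence {x} {y ∷ ys} x∈ with x ≟ y
    ... | yes refl = [] , ys , refl , λ ()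
    ... | no x≢y with U , V , refl , x∉U ← first-occurrence (Any.tail x≢y x∈) =
      y ∷ U , V , refl , λ { (here x≡y) → x≢y x≡y ; (there x∈U) → x∉U x∈U }

    last-occurrence : ∀ {x xs} → x ∈ xs → ∃₂ λ U V → xs ≡ U ++ x ∷ V × x ∉ V
    last-occurrence {x} {y ∷ ys} x∈ with x ∈? ys
    ... | yes x∈ys with U , V , refl , x∉V ← last-occurrence x∈ys = y ∷ U , V , refl , x∉V
    last-occurrence {x} {y ∷ ys} (here refl)   | no x∉ys = [] , ys , refl , x∉ys
    last-occurrence {x} {y ∷ ys} (there x∈ys) | no x∉ys = ⊥-elim (x∉ys x∈ys)

_≟ₑ_ : ∀ {n} → DecidableEquality (Edge n)
_≟ₑ_ = ≡-dec Fin._≟_ Fin._≟_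

_∈ₑ?_ : ∀ {n} (e : Edge n) es → Dec (e ∈ es)
_∈ₑ?_ = DecMembership._∈?_ _≟ₑ_

module _ {n : ℕ} {E : List (Edge n)} where

  walk-++ : ∀ {u m v xs ys} → Walk E u m xs → Walk E m v ys → Walk E u v (xs ++ ys)
  walk-++ (_ , nil)                w₂ = w₂
  walk-++ (x∈E ∷ xs∈E , cons _ c) w₂ with ys∈E , c′ ← walk-++ (xs∈E , c) w₂ =
    x∈E ∷ ys∈E , cons _ c′

  walk-via : ∀ {u v x xs ys} → Walk E u (tail x) xs → x ∈ E → Walk E (head' x) v ys →
    Walk E u v (xs ++ x ∷ ys)
  walk-via {x = x} w₁ x∈E (ys∈E , c) = walk-++ w₁ (x∈E ∷ ys∈E , cons (head' x) c)

  walk-via⁻ : ∀ xs {x ys u v} → Walk E u v (xs ++ x ∷ ys) →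
    Walk E u (tail x) xs × x ∈ E × Walk E (head' x) v ys
  walk-via⁻ [] (x∈E ∷ ys∈E , cons _ c) = ([] , nil) , x∈E , (ys∈E , c)
  walk-via⁻ (y ∷ xs) (y∈E ∷ rest∈E , cons _ c)
    with (xs∈E , c₁) , x∈E , w₂ ← walk-via⁻ xs (rest∈E , c) = (y∈E ∷ xs∈E , cons _ c₁) , x∈E , w₂

  vertices : Fin n → List (Edge n) → List (Fin n)
  vertices u P = u ∷ map head' P

  vertices-chain : ∀ {u v P} → Chain u v P → vertices u P ≡ map tail P ++ v ∷ []
  vertices-chain nil        = refl
  vertices-chain (cons _ c) = cong (_ ∷_) (vertices-chain c)

  SimplePath : Fin n → Fin n → List (Edge n) → Set
  SimplePath u v P = Walk E u v P × Unique (vertices u P)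

  simple-tails : ∀ {u v P} → SimplePath u v P → Unique (map tail P) × v ∉ map tail P
  simple-tails {P = P} ((_ , c) , u) rewrite vertices-chain c =
    unique-++⁻ˡ (map tail P) u , λ v∈ → unique-++⇒disjoint (map tail P) u (v∈ , here refl)

  simple⇒path : ∀ {u v P} → SimplePath u v P → Path E u v P
  simple⇒path p@(w , _ ∷ heads-unique) = w , proj₁ (simple-tails p) , heads-unique

  simple-suffix : ∀ {u a v Q} → SimplePath a v Q → u ∈ vertices a Q →
    ∃ λ Q′ → SimplePath u v Q′ × Q′ ⊆ Q
  simple-suffix p (here refl) = _ , p , λ q → q
  simple-suffix ((_ ∷ Q∈E , cons _ c) , _ ∷ u) (there u∈)
    with Q′ , p′ , Q′⊆ ← simple-suffix ((Q∈E , c) , u) u∈ = Q′ , p′ , there ∘ Q′⊆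

  walk⇒simplePath : ∀ {u v} ws → Walk E u v ws → ∃ λ P → SimplePath u v P × P ⊆ ws
  walk⇒simplePath [] ([] , nil) = [] , (([] , nil) , [] ∷ []) , λ ()
  walk⇒simplePath {u} (x ∷ ws) (x∈E ∷ ws∈E , cons a c)
    with Q , Q-simple@((Q∈E , Q-chain) , Q-unique) , Q⊆ ← walk⇒simplePath ws (ws∈E , c)
    with DecMembership._∈?_ Fin._≟_ u (vertices a Q)
  ... | yes u∈ with Q′ , p′ , Q′⊆ ← simple-suffix Q-simple u∈ = Q′ , p′ , there ∘ Q⊆ ∘ Q′⊆
  ... | no u∉ =
    x ∷ Q , ((x∈E ∷ Q∈E , cons a Q-chain) , ¬Any⇒All¬ _ u∉ ∷ Q-unique) ,
    λ { (here refl) → here refl ; (there q) → there (Q⊆ q) }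

  chain-≢⇒nonempty : ∀ {u v : Fin n} {P} → Chain u v P → u ≢ v → P ≢ []
  chain-≢⇒nonempty nil        u≢u refl = u≢u refl
  chain-≢⇒nonempty (cons _ _) _   ()

  walk⇒nonempty-path : ∀ {u v x} ws → Walk E u v (x ∷ ws) → ∃ λ P → Path E u v P × P ≢ [] × P ⊆ x ∷ ws
  walk⇒nonempty-path {u} {v} ws w with u Fin.≟ v
  ... | no u≢v with P , P-simple , P⊆ ← walk⇒simplePath _ w =
    P , simple⇒path P-simple , chain-≢⇒nonempty (proj₂ (proj₁ P-simple)) u≢v , P⊆
  -- A closed walk may simplify to the empty path; keep its first edge, closing a cycle.
  walk⇒nonempty-path ws (x∈E ∷ ws∈E , cons a c) | yes refl
    with Q , Q-simple@((Q∈E , Q-chain) , Q-unique) , Q⊆ ← walk⇒simplePath ws (ws∈E , c)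
    with tails-unique , u∉tails ← simple-tails Q-simple =
    _ ∷ Q , ((x∈E ∷ Q∈E , cons a Q-chain) , ¬Any⇒All¬ _ u∉tails ∷ tails-unique , Q-unique) ,
    (λ ()) , λ { (here refl) → here refl ; (there q) → there (Q⊆ q) }

  bridge-∈-walk : ∀ {s t y ws} → IsBridge E s t y → Walk E s t ws → y ∈ ws
  bridge-∈-walk {y = y} {ws} (_ , no-avoiding-path) w =
    decidable-stable (y ∈ₑ? ws) λ y∉ws →
      let P , P-simple , P⊆ = walk⇒simplePath ws w
      in no-avoiding-path (P , simple⇒path P-simple , y∉ws ∘ P⊆)

module BridgeSubstring {n : ℕ} (E : List (Edge n)) (s t : Fin n)
  (π : List (Edge n)) (π-path : Path E s t π)
  (B : List (Edge n)) (B-bridges : IsBridgeSeq E s t B)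
  (e₁ : Edge n) (L′ αB βB : List (Edge n)) (B≡ : B ≡ αB ++ ((e₁ ∷ L′) ++ βB)) where

  L : List (Edge n)
  L = e₁ ∷ L′

  eₖ : Edge n
  eₖ = proj₁ (last-∷-just e₁ L′)

  last-L : last L ≡ just eₖ
  last-L = proj₂ (last-∷-just e₁ L′)

  π-unique : Unique π
  π-unique = map⁻ (proj₁ (proj₂ π-path))

  π-disjoint : ∀ π₁ {π₂} → π ≡ π₁ ++ π₂ → Disjoint π₁ π₂
  π-disjoint π₁ π≡ = unique-++⇒disjoint π₁ (subst Unique π≡ π-unique)

  π-∉-middle : ∀ π₁ {x π₂} → π ≡ π₁ ++ x ∷ π₂ → x ∉ π₁ × x ∉ π₂
  π-∉-middle π₁ π≡ = unique-∉-middle π₁ (subst Unique π≡ π-unique)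

  L-unique : Unique L
  L-unique = unique-++⁻ˡ L (unique-++⁻ʳ αB (subst Unique B≡ (proj₁ B-bridges)))

  L-∉-middle : ∀ P {x R} → L ≡ P ++ x ∷ R → x ∉ P × x ∉ R
  L-∉-middle P L≡ = unique-∉-middle P (subst Unique L≡ L-unique)

  L-bridge : ∀ {y} → y ∈ L → IsBridge E s t y
  L-bridge {y} y∈L =
    Equivalence.to (proj₁ (proj₂ B-bridges) y) (subst (y ∈_) (sym B≡) (∈-++⁺ʳ αB (∈-++⁺ˡ y∈L)))

  π-segments : ∀ π₁ {x π₂} → π ≡ π₁ ++ x ∷ π₂ →
    Walk E s (tail x) π₁ × x ∈ E × Walk E (head' x) t π₂
  π-segments π₁ π≡ = walk-via⁻ π₁ (subst (Walk E s t) π≡ (proj₁ π-path))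

  B≡-at : ∀ P {x R} → L ≡ P ++ x ∷ R → B ≡ (αB ++ P) ++ x ∷ (R ++ βB)
  B≡-at P {x} {R} L≡ = begin
    B                             ≡⟨ B≡ ⟩
    αB ++ (L ++ βB)               ≡⟨ cong (λ l → αB ++ (l ++ βB)) L≡ ⟩
    αB ++ ((P ++ x ∷ R) ++ βB)    ≡⟨ cong (αB ++_) (++-assoc P (x ∷ R) βB) ⟩
    αB ++ (P ++ x ∷ (R ++ βB))    ≡⟨ ++-assoc αB P (x ∷ R ++ βB) ⟨
    (αB ++ P) ++ x ∷ (R ++ βB)    ∎
    where open ≡-Reasoning

  π-split : ∀ P {x R} → L ≡ P ++ x ∷ R →
    ∃₂ λ π₁ π₂ → π ≡ π₁ ++ x ∷ π₂ × P ⊆ π₁ × R ⊆ π₂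
  π-split P L≡
    with π₁ , π₂ , π≡ , P⊑ , R⊑
           ← ⊑-split (αB ++ P) (subst (_⊑ π) (B≡-at P L≡) (proj₂ (proj₂ B-bridges) π π-path)) =
    π₁ , π₂ , π≡ , Sublist.lookup P⊑ ∘ ∈-++⁺ʳ αB , Sublist.lookup R⊑ ∘ ∈-++⁺ˡ

  no-bypass : ∀ P {x R y C} → L ≡ P ++ x ∷ R → y ∈ R → Walk E (head' x) t C → y ∉ C → ⊥
  no-bypass P {x} L≡ y∈R C-walk y∉C
    with π₁ , π₂ , π≡ , _ , R⊆π₂ ← π-split P L≡
    with π₁-walk , x∈E , _ ← π-segments π₁ π≡ =
    y∉π₁xC (bridge-∈-walk (L-bridge (subst (_ ∈_) (sym L≡) (∈-++⁺ʳ P (there y∈R))))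
                          (walk-via π₁-walk x∈E C-walk))
    where
    y∉π₁xC : _ ∉ π₁ ++ x ∷ _
    y∉π₁xC y∈ with ∈-++⁻ π₁ y∈
    ... | inj₁ y∈π₁        = π-disjoint π₁ π≡ (y∈π₁ , there (R⊆π₂ y∈R))
    ... | inj₂ (here refl) = proj₂ (π-∉-middle π₁ π≡) (R⊆π₂ y∈R)
    ... | inj₂ (there y∈C) = y∉C y∈C

  no-bypass-to : ∀ P {x R} P′ {z R′ y D} → L ≡ P ++ x ∷ R → L ≡ P′ ++ z ∷ R′ → y ∈ R → y ∈ P′ →
    Walk E (head' x) (tail z) D → y ∉ D → ⊥
  no-bypass-to P P′ {z} L≡ L≡′ y∈R y∈P′ D-walk y∉D
    with ρ₁ , ρ₂ , ρ≡ , P′⊆ρ₁ , _ ← π-split P′ L≡′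
    with _ , z∈E , ρ₂-walk ← π-segments ρ₁ ρ≡ =
    no-bypass P L≡ y∈R (walk-via D-walk z∈E ρ₂-walk)
      ([ y∉D , (λ y∈zρ₂ → π-disjoint ρ₁ ρ≡ (P′⊆ρ₁ y∈P′ , y∈zρ₂)) ]′ ∘ ∈-++⁻ _)

  L≡-shift : ∀ P {x y R} → L ≡ P ++ x ∷ y ∷ R → L ≡ (P ++ x ∷ []) ++ y ∷ R
  L≡-shift P {x} L≡ = trans L≡ (sym (∷ʳ-++ P x _))

  safe⇒no-breaker : SafeWalks E s t L → ¬ WalkBreaker E L
  safe⇒no-breaker safe (xs , e , e′ , ys , L≡ , Q , Q≢[] , (Q-walk , _) , Q-avoids)
    with τ₁ , τ₂ , π≡τ , pre⊆τ₁ , _ ← π-split (xs ++ e ∷ []) (L≡-shift xs L≡)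
    with π₁ , π₂ , refl ← ∈-∃++ (pre⊆τ₁ (∈-++⁺ʳ xs (here refl)))
    with τ₁-walk , e′∈E , τ₂-walk ← π-segments (π₁ ++ e ∷ π₂) π≡τ
    with π₁-walk , e∈E , _ ← walk-via⁻ π₁ τ₁-walk
    with α , β , W≡
           ← safe (π₁ ++ e ∷ (Q ++ e′ ∷ τ₂)) (walk-via π₁-walk e∈E (walk-via Q-walk e′∈E τ₂-walk)) =
    proj₂ (All.lookup Q-avoids eₖ∈Q) last-L
    where
    e∉π₁ : e ∉ π₁
    e∉π₁ = proj₁ (π-∉-middle π₁ (trans π≡τ (++-assoc π₁ (e ∷ π₂) (e′ ∷ τ₂))))

    e₁∉Z : e₁ ∉ Q ++ e′ ∷ τ₂
    e₁∉Z = [ (λ e₁∈Q → proj₁ (All.lookup Q-avoids e₁∈Q) refl) ,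
             (λ e₁∈e′τ₂ → π-disjoint (π₁ ++ e ∷ π₂) π≡τ
                            (pre⊆τ₁ (head-∈-prefix xs L≡) , e₁∈e′τ₂)) ]′
           ∘ ∈-++⁻ Q

    Z≡ : Q ++ e′ ∷ τ₂ ≡ e′ ∷ (ys ++ β)
    Z≡ = aligned-suffix π₁ α (trans W≡ (cong (λ l → α ++ (l ++ β)) L≡))
           e∉π₁ (proj₁ (L-∉-middle xs L≡)) (subst (e₁ ∈_) L≡ (here refl)) e₁∉Z

    eₖ∈Q : eₖ ∈ Q
    eₖ∈Q = ∷-prefix-⊆ Q Q≢[] Z≡ (proj₂ (L-∉-middle (xs ++ e ∷ []) (L≡-shift xs L≡)))
             (last-∈ (xs ++ e ∷ []) (subst (λ l → last l ≡ just eₖ) (L≡-shift xs L≡) last-L))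

  module _ (no-breaker : ¬ WalkBreaker E L) where

    no-detour : ∀ P {e e′ R} X → L ≡ P ++ e ∷ e′ ∷ R →
      Walk E (head' e) (tail e′) X → e₁ ∉ X → e′ ∉ X → X ≡ []
    no-detour P [] _ _ _ _ = refl
    no-detour P {e} {e′} {R} X@(_ ∷ _) L≡ X-walk e₁∉X e′∉X with eₖ ∈ₑ? X
    ... | no eₖ∉X with D , D-path , D≢[] , D⊆X ← walk⇒nonempty-path _ X-walk =
      ⊥-elim (no-breaker (P , e , e′ , R , L≡ , D , D≢[] , D-path , All.tabulate λ f∈D →
        ∉-∈⇒just≢ e₁∉X (D⊆X f∈D) , λ eq → ∉-∈⇒just≢ eₖ∉X (D⊆X f∈D) (trans (sym last-L) eq)))
    ... | yes eₖ∈X with last-∈ (P ++ e ∷ []) (subst (λ l → last l ≡ just eₖ) (L≡-shift P L≡) last-L)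
    ...   | here refl = ⊥-elim (e′∉X eₖ∈X)
    ...   | there eₖ∈R
      with R₁ , R₂ , refl ← ∈-∃++ eₖ∈R
      with X₁ , X₂ , X≡ ← ∈-∃++ eₖ∈X
      with X₁-walk , _ ← walk-via⁻ X₁ (subst (Walk E (head' e) (tail e′)) X≡ X-walk) =
      ⊥-elim (no-bypass-to P (P ++ e ∷ e′ ∷ R₁) L≡
        (trans L≡ (sym (++-assoc P (e ∷ e′ ∷ R₁) (eₖ ∷ R₂))))
        (here refl) (∈-++⁺ʳ P (there (here refl))) X₁-walk
        (e′∉X ∘ subst (e′ ∈_) (sym X≡) ∘ ∈-++⁺ˡ))

    continues-along-L : ∀ R P {e C} → L ≡ P ++ e ∷ R → Walk E (head' e) t C → e₁ ∉ C →
      ∃ λ ys → C ≡ R ++ ys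
    continues-along-L []       _ _ _ _ = _ , refl
    continues-along-L (e′ ∷ R) P {e} {C} L≡ C-walk e₁∉C
      with X , Y , refl , e′∉X ← first-occurrence _≟ₑ_
             (decidable-stable (e′ ∈ₑ? C) (no-bypass P L≡ (here refl) C-walk))
      with X-walk , _ , Y-walk ← walk-via⁻ X C-walk
      with refl ← no-detour P X L≡ X-walk (e₁∉C ∘ ∈-++⁺ˡ) e′∉X
      with ys , refl ← continues-along-L R (P ++ e ∷ []) (L≡-shift P L≡) Y-walk (e₁∉C ∘ there) =
      ys , refl

    no-breaker⇒safe : SafeWalks E s t L
    no-breaker⇒safe W W-walk
      with A , C , refl , e₁∉C ← last-occurrence _≟ₑ_ (bridge-∈-walk (L-bridge (here refl)) W-walk)
      with _ , _ , C-walk ← walk-via⁻ A W-walk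
      with ys , refl ← continues-along-L L′ [] refl C-walk e₁∉C =
      A , ys , refl

theorem12 : (n : ℕ) (E : List (Edge n)) → Unique E →
    (s t : Fin n) → ∃[ es ] Path E s t es →
    (B : List (Edge n)) → IsBridgeSeq E s t B →
    (L : List (Edge n)) → IsSubstring L B →
    SafeWalks E s t L ⇔ (¬ WalkBreaker E L)
theorem12 n E _ s t (π , π-path) B B-bridges [] _ =
  mk⇔ (λ _ → λ { ([] , _ , _ , _ , () , _) ; (_ ∷ _ , _ , _ , _ , () , _) })
      (λ _ W _ → [] , W , refl)
theorem12 n E _ s t (π , π-path) B B-bridges (e₁ ∷ L′) (αB , βB , B≡) =
  mk⇔ safe⇒no-breaker no-breaker⇒safe
  where open BridgeSubstring E s t π π-path B B-bridges e₁ L′ αB βB B≡
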